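{- Let $d\ge1$ and let $G$ be a finite $2d$-regular graph. Then every monotone dynamo on $G$ under the majority process has at least $\big(1-\frac{d}{d+2}\big)|V(G)|$ active vertices; i.e. $\overleftarrow{m}_{mon}(G,maj)\ge\big(1-\frac{d}{d+2}\big)|G|$.
   Context: A configuration assigns each vertex a state active (1) or inactive (0); its size is the number of active vertices. Majority process: in each round $t\ge1$, simultaneously, vertex $v$ becomes active if $\sum_{u\in N(v)}\omega^{(t-1)}_u+\omega^{(t-1)}_v/2>\deg(v)/2$ and inactive otherwise (each vertex adopts the majority state among its neighbors and keeps its state in case of a tie). A dynamo is an initial configuration $\omega^{(0)}$ such that from some time on all vertices are active forever; it is monotone if moreover $\omega^{(t+1)}\ge\omega^{(t)}$ coordinatewise for all $t\ge0$. $\overleftarrow{m}_{mon}(G,maj)$ is the minimum size of a monotone dynamo under the majority process on $G$, and $|G|$ is the number of vertices. -}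

module Defs where

open import Data.Nat using (ℕ; zero; suc; _+_; _*_; _≤_; _<_; _≥_)
open import Data.Bool using (Bool; true; false; T?; _∧_)
import Data.Bool
open import Data.Fin using (Fin)
open import Data.List using (List; length; filter)
open import Data.List.Base using (allFin)
open import Data.Product using (Σ; _×_; ∃; ∃-syntax)
open import Relation.Binary.PropositionalEquality using (_≡_)
open import Data.Nat using (_<ᵇ_)

record Graph (n : ℕ) : Set where
  field
    adj       : Fin n → Fin n → Bool
    symmetric : ∀ u v → adj u v ≡ adj v u
    loopless  : ∀ v → adj v v ≡ false

open Graph public

-- configurations: true = active (1), false = inactive (0)
Config : ℕ → Set
Config n = Fin n → Bool

count : ∀ {n} → (Fin n → Bool) → ℕ
count {n} p = length (filter (λ u → T? (p u)) (allFin n))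

deg : ∀ {n} → Graph n → Fin n → ℕ
deg G v = count (adj G v)

Regular : ∀ {n} → ℕ → Graph n → Set
Regular k G = ∀ v → deg G v ≡ k

activeNbrs : ∀ {n} → Graph n → Config n → Fin n → ℕ
activeNbrs G ω v = count (λ u → adj G v u ∧ ω u)

size : ∀ {n} → Config n → ℕ
size ω = count ω

b2n : Bool → ℕ
b2n true  = 1
b2n false = 0

-- one round of the majority process:
-- v active iff  Σ_{u∈N(v)} ω_u + ω_v/2 > deg(v)/2,
-- equivalently (multiplying by 2)  2·Σ_{u∈N(v)} ω_u + ω_v > deg(v).
majStep : ∀ {n} → Graph n → Config n → Config n
majStep G ω v = deg G v <ᵇ (2 * activeNbrs G ω v + b2n (ω v))

majIter : ∀ {n} → Graph n → Config n → ℕ → Config n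
majIter G ω zero    = ω
majIter G ω (suc t) = majStep G (majIter G ω t)

IsDynamo : ∀ {n} → Graph n → Config n → Set
IsDynamo G ω = ∃[ T₀ ] (∀ t → T₀ ≤ t → ∀ v → majIter G ω t v ≡ true)

IsMonotone : ∀ {n} → Graph n → Config n → Set
IsMonotone G ω = ∀ t v → majIter G ω t v Data.Bool.≤ majIter G ω (suc t) v

IsMonotoneDynamo : ∀ {n} → Graph n → Config n → Set
IsMonotoneDynamo G ω = IsDynamo G ω × IsMonotone G ω

module Submission where

-- Track the potential cut x + 2 ∣x∣, where cut x is the number of edges joining an active to an
-- inactive vertex. In a monotone run a vertex that becomes active had at least d + 1 active
-- neighbours, so it takes at least d + 1 edges out of the cut and puts at most d − 1 in: the
-- potential never increases. Initially every active vertex stays active, so it has at most d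
-- inactive neighbours and cut ω ≤ d ∣ω∣; once all n vertices are active the potential is ≥ 2n.

open import Defs
open import Data.Nat using (ℕ; zero; suc; _+_; _*_; _≤_; _<_; z≤n)
open import Data.Nat.Properties
open import Data.Nat.Tactic.RingSolver using (solve-∀)
open import Algebra.Properties.Semiring.Sum +-*-semiring
  using (sum-syntax; ∑-distrib-+; ∑-comm; *-distribˡ-sum; sum-cong-≗)
open import Data.Bool using (Bool; true; false; not; _∧_; T; T?; f≤t; b≤b)
import Data.Bool as Bool
open import Data.Fin as Fin using (Fin)
open import Data.List using (length; filter; tabulate)
open import Data.Product using (_×_; _,_)
open import Data.Unit using (tt)
open import Function using (_∘_; id)
open import Relation.Binary.PropositionalEquality

b2n-∧ : ∀ a b → b2n (a ∧ b) ≡ b2n a * b2n b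
b2n-∧ false b = refl
b2n-∧ true  b = sym (+-identityʳ (b2n b))

b2n-split : ∀ a b → b2n a ≡ b2n (a ∧ b) + b2n (a ∧ not b)
b2n-split false b     = refl
b2n-split true  false = refl
b2n-split true  true  = refl

b2n-mono : ∀ {a b} → a Bool.≤ b → b2n a ≤ b2n b
b2n-mono f≤t = z≤n
b2n-mono b≤b = ≤-refl

b2n-≤-split : ∀ {a b} → a Bool.≤ b → b2n b ≡ b2n a + b2n (not a ∧ b)
b2n-≤-split f≤t           = refl
b2n-≤-split (b≤b {false}) = refl
b2n-≤-split (b≤b {true})  = refl

not-antitone : ∀ {a b} → a Bool.≤ b → not b Bool.≤ not a
not-antitone f≤t = f≤t
not-antitone b≤b = b≤b

true≤⇒≡true : ∀ {b} → true Bool.≤ b → b ≡ true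
true≤⇒≡true b≤b = refl

b2n-*-monoʳ-≤ : ∀ {b m n} → (b ≡ true → m ≤ n) → b2n b * m ≤ b2n b * n
b2n-*-monoʳ-≤ {false} m≤n = z≤n
b2n-*-monoʳ-≤ {true}  m≤n = *-monoʳ-≤ 1 (m≤n refl)

∑-mono-≤ : ∀ {n} {f g : Fin n → ℕ} → (∀ i → f i ≤ g i) →
  ∑[ i < n ] f i ≤ ∑[ i < n ] g i
∑-mono-≤ {zero}  f≤g = z≤n
∑-mono-≤ {suc n} f≤g = +-mono-≤ (f≤g Fin.zero) (∑-mono-≤ (f≤g ∘ Fin.suc))

∑-ones : ∀ n → ∑[ i < n ] 1 ≡ n
∑-ones zero    = refl
∑-ones (suc n) = cong suc (∑-ones n)

count≡∑ : ∀ {n} (p : Fin n → Bool) → count p ≡ ∑[ i < n ] b2n (p i)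
count≡∑ {n} p = length-filter-tabulate id
  where
  length-filter-tabulate : ∀ {m} (f : Fin m → Fin n) →
    length (filter (λ u → T? (p u)) (tabulate f)) ≡ ∑[ i < m ] b2n (p (f i))
  length-filter-tabulate {zero}  f = refl
  length-filter-tabulate {suc m} f with p (f Fin.zero)
  ... | true  = cong suc (length-filter-tabulate (f ∘ Fin.suc))
  ... | false = length-filter-tabulate (f ∘ Fin.suc)

2*m<2*n+0⇒m<n : ∀ {m n} → 2 * m < 2 * n + 0 → m < n
2*m<2*n+0⇒m<n {m} {n} lt = *-cancelˡ-< 2 m n (subst (2 * m <_) (+-identityʳ (2 * n)) lt)

2*m<2*n+1⇒m≤n : ∀ {m n} → 2 * m < 2 * n + 1 → m ≤ n
2*m<2*n+1⇒m≤n {m} {n} lt =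
  *-cancelˡ-≤ 2 (m<1+n⇒m≤n (subst (2 * m <_) (+-comm (2 * n) 1) lt))

potential-drop : ∀ {a b p q k s s′} →
  a + p ≡ b + q → q + 2 * k ≤ p → s′ ≡ s + k → a + 2 * s′ ≤ b + 2 * s
potential-drop {a} {b} {p} {q} {k} {s} {s′} exchange margin refl = +-cancelʳ-≤ q _ _ (begin
  a + 2 * (s + k) + q     ≡⟨ regroupˡ a q k s ⟩
  a + (q + 2 * k) + 2 * s ≤⟨ +-monoˡ-≤ (2 * s) (+-monoʳ-≤ a margin) ⟩
  a + p + 2 * s           ≡⟨ cong (_+ 2 * s) exchange ⟩
  b + q + 2 * s           ≡⟨ regroupʳ b q s ⟩
  b + 2 * s + q           ∎)
  where
  open ≤-Reasoning
  regroupˡ : ∀ a q k s → a + 2 * (s + k) + q ≡ a + (q + 2 * k) + 2 * s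
  regroupˡ = solve-∀
  regroupʳ : ∀ b q s → b + q + 2 * s ≡ b + 2 * s + q
  regroupʳ = solve-∀

_⊆_ : ∀ {n} → Config n → Config n → Set
x ⊆ y = ∀ v → x v Bool.≤ y v

newlyActive : ∀ {n} → Config n → Config n → Config n
newlyActive x y v = not (x v) ∧ y v

edge-exchange : ∀ {xv yv xu yu} → xv Bool.≤ yv → xu Bool.≤ yu →
  b2n yv * b2n (not yu) + b2n (not xu ∧ yu) * b2n xv
  ≡ b2n xv * b2n (not xu) + b2n (not xv ∧ yv) * b2n (not yu)
edge-exchange f≤t           f≤t           = refl
edge-exchange f≤t           (b≤b {false}) = refl
edge-exchange f≤t           (b≤b {true})  = refl
edge-exchange (b≤b {false}) f≤t           = refl
edge-exchange (b≤b {false}) (b≤b {false}) = refl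
edge-exchange (b≤b {false}) (b≤b {true})  = refl
edge-exchange (b≤b {true})  f≤t           = refl
edge-exchange (b≤b {true})  (b≤b {false}) = refl
edge-exchange (b≤b {true})  (b≤b {true})  = refl

newlyActive≡true : ∀ {n} {x y : Config n} {v} →
  newlyActive x y v ≡ true → x v ≡ false × y v ≡ true
newlyActive≡true {x = x} {y} {v} new with x v | y v
... | false | true = refl , refl

size-⊆ : ∀ {n} {x y : Config n} → x ⊆ y →
  size y ≡ size x + ∑[ v < n ] b2n (newlyActive x y v)
size-⊆ {n} {x} {y} x⊆y = begin
  size y                                 ≡⟨ count≡∑ y ⟩
  ∑[ v < n ] b2n (y v)                   ≡⟨ sum-cong-≗ (b2n-≤-split ∘ x⊆y) ⟩
  ∑[ v < n ] (b2n (x v) + b2n (new v))   ≡⟨ ∑-distrib-+ (b2n ∘ x) (b2n ∘ new) ⟩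
  ∑[ v < n ] b2n (x v) + B               ≡⟨ cong (_+ B) (count≡∑ x) ⟨
  size x + B                             ∎
  where
  open ≡-Reasoning
  new = newlyActive x y
  B = ∑[ v < n ] b2n (new v)

size-all-active : ∀ {n} {x : Config n} → (∀ v → x v ≡ true) → size x ≡ n
size-all-active {n} {x} all =
  trans (count≡∑ x) (trans (sum-cong-≗ (cong b2n ∘ all)) (∑-ones n))

module _ {n} (G : Graph n) where

  inactiveNbrs : Config n → Fin n → ℕ
  inactiveNbrs x = activeNbrs G (not ∘ x)

  activeNbrs+inactiveNbrs≡deg : ∀ x v → activeNbrs G x v + inactiveNbrs x v ≡ deg G v
  activeNbrs+inactiveNbrs≡deg x v = begin
    activeNbrs G x v + inactiveNbrs x v
      ≡⟨ cong₂ _+_ (count≡∑ (λ u → adj G v u ∧ x u))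
                   (count≡∑ (λ u → adj G v u ∧ not (x u))) ⟩
    ∑[ u < n ] b2n (adj G v u ∧ x u) + ∑[ u < n ] b2n (adj G v u ∧ not (x u))
      ≡⟨ ∑-distrib-+ (λ u → b2n (adj G v u ∧ x u)) (λ u → b2n (adj G v u ∧ not (x u))) ⟨
    ∑[ u < n ] (b2n (adj G v u ∧ x u) + b2n (adj G v u ∧ not (x u)))
      ≡⟨ sum-cong-≗ (λ u → b2n-split (adj G v u) (x u)) ⟨
    ∑[ u < n ] b2n (adj G v u)
      ≡⟨ count≡∑ (adj G v) ⟨
    deg G v ∎
    where open ≡-Reasoning

  activeNbrs-mono : ∀ {x y} → x ⊆ y → ∀ v → activeNbrs G x v ≤ activeNbrs G y v
  activeNbrs-mono {x} {y} x⊆y v = begin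
    activeNbrs G x v                       ≡⟨ count≡∑ (λ u → adj G v u ∧ x u) ⟩
    ∑[ u < n ] b2n (adj G v u ∧ x u)       ≤⟨ ∑-mono-≤ edgewise ⟩
    ∑[ u < n ] b2n (adj G v u ∧ y u)       ≡⟨ count≡∑ (λ u → adj G v u ∧ y u) ⟨
    activeNbrs G y v                       ∎
    where
    open ≤-Reasoning
    edgewise : ∀ u → b2n (adj G v u ∧ x u) ≤ b2n (adj G v u ∧ y u)
    edgewise u rewrite b2n-∧ (adj G v u) (x u) | b2n-∧ (adj G v u) (y u) =
      *-monoʳ-≤ (b2n (adj G v u)) (b2n-mono (x⊆y u))

  inactiveNbrs-antitone : ∀ {x y} → x ⊆ y → ∀ v → inactiveNbrs y v ≤ inactiveNbrs x v
  inactiveNbrs-antitone x⊆y = activeNbrs-mono (not-antitone ∘ x⊆y)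

  majStep≡true⇒ : ∀ x v → majStep G x v ≡ true →
    deg G v < 2 * activeNbrs G x v + b2n (x v)
  majStep≡true⇒ x v active = <ᵇ⇒< _ _ (subst T (sym active) tt)

  edgeSum : (Fin n → Fin n → ℕ) → ℕ
  edgeSum f = ∑[ v < n ] ∑[ u < n ] (b2n (adj G v u) * f v u)

  edgeSum-cong : ∀ {f g} → (∀ v u → f v u ≡ g v u) → edgeSum f ≡ edgeSum g
  edgeSum-cong f≡g =
    sum-cong-≗ (λ v → sum-cong-≗ (λ u → cong (b2n (adj G v u) *_) (f≡g v u)))

  edgeSum-+ : ∀ f g → edgeSum f + edgeSum g ≡ edgeSum (λ v u → f v u + g v u)
  edgeSum-+ f g = begin
    edgeSum f + edgeSum g
      ≡⟨ ∑-distrib-+ (λ v → ∑[ u < n ] (b2n (adj G v u) * f v u))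
                     (λ v → ∑[ u < n ] (b2n (adj G v u) * g v u)) ⟨
    ∑[ v < n ] (∑[ u < n ] (b2n (adj G v u) * f v u) + ∑[ u < n ] (b2n (adj G v u) * g v u))
      ≡⟨ sum-cong-≗ (λ v → ∑-distrib-+ (λ u → b2n (adj G v u) * f v u)
                                       (λ u → b2n (adj G v u) * g v u)) ⟨
    ∑[ v < n ] ∑[ u < n ] (b2n (adj G v u) * f v u + b2n (adj G v u) * g v u)
      ≡⟨ sum-cong-≗ (λ v → sum-cong-≗ (λ u →
           *-distribˡ-+ (b2n (adj G v u)) (f v u) (g v u))) ⟨
    edgeSum (λ v u → f v u + g v u) ∎
    where open ≡-Reasoning

  edgeSum-transpose : ∀ f → edgeSum f ≡ edgeSum (λ v u → f u v)
  edgeSum-transpose f = trans (∑-comm (λ v u → b2n (adj G v u) * f v u))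
    (sum-cong-≗ (λ u → sum-cong-≗ (λ v →
      cong (λ a → b2n a * f v u) (symmetric G v u))))

  ∑-b2n*activeNbrs : ∀ (s t : Config n) →
    ∑[ v < n ] (b2n (s v) * activeNbrs G t v) ≡ edgeSum (λ v u → b2n (s v) * b2n (t u))
  ∑-b2n*activeNbrs s t = sum-cong-≗ λ v → begin
    b2n (s v) * activeNbrs G t v
      ≡⟨ cong (b2n (s v) *_) (count≡∑ (λ u → adj G v u ∧ t u)) ⟩
    b2n (s v) * ∑[ u < n ] b2n (adj G v u ∧ t u)
      ≡⟨ *-distribˡ-sum (b2n (s v)) (λ u → b2n (adj G v u ∧ t u)) ⟩
    ∑[ u < n ] (b2n (s v) * b2n (adj G v u ∧ t u))
      ≡⟨ sum-cong-≗ (λ u → trans (cong (b2n (s v) *_) (b2n-∧ (adj G v u) (t u)))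
                                 (*-leftComm (b2n (s v)) (b2n (adj G v u)) (b2n (t u)))) ⟩
    ∑[ u < n ] (b2n (adj G v u) * (b2n (s v) * b2n (t u))) ∎
    where
    open ≡-Reasoning
    *-leftComm : ∀ a b c → a * (b * c) ≡ b * (a * c)
    *-leftComm = solve-∀

  cut : Config n → ℕ
  cut x = ∑[ v < n ] (b2n (x v) * inactiveNbrs x v)

  -- The second summands count the edges leaving the cut (from old active vertices into newly
  -- activated ones) and the edges entering it (from newly activated vertices to inactive ones).
  cut-exchange : ∀ {x y} → x ⊆ y →
    cut y + ∑[ v < n ] (b2n (newlyActive x y v) * activeNbrs G x v)
    ≡ cut x + ∑[ v < n ] (b2n (newlyActive x y v) * inactiveNbrs y v)
  cut-exchange {x} {y} x⊆y = begin
    cut y + ∑[ v < n ] (b2n (newlyActive x y v) * activeNbrs G x v)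
      ≡⟨ cong₂ _+_ (∑-b2n*activeNbrs y (not ∘ y))
                   (trans (∑-b2n*activeNbrs (newlyActive x y) x) (edgeSum-transpose _)) ⟩
    edgeSum (λ v u → b2n (y v) * b2n (not (y u)))
      + edgeSum (λ v u → b2n (newlyActive x y u) * b2n (x v))
      ≡⟨ edgeSum-+ _ _ ⟩
    edgeSum (λ v u → b2n (y v) * b2n (not (y u)) + b2n (newlyActive x y u) * b2n (x v))
      ≡⟨ edgeSum-cong (λ v u → edge-exchange (x⊆y v) (x⊆y u)) ⟩
    edgeSum (λ v u → b2n (x v) * b2n (not (x u)) + b2n (newlyActive x y v) * b2n (not (y u)))
      ≡⟨ edgeSum-+ _ _ ⟨
    edgeSum (λ v u → b2n (x v) * b2n (not (x u)))
      + edgeSum (λ v u → b2n (newlyActive x y v) * b2n (not (y u)))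
      ≡⟨ cong₂ _+_ (∑-b2n*activeNbrs x (not ∘ x))
                   (∑-b2n*activeNbrs (newlyActive x y) (not ∘ y)) ⟨
    cut x + ∑[ v < n ] (b2n (newlyActive x y v) * inactiveNbrs y v) ∎
    where open ≡-Reasoning

module _ (d : ℕ) {n} (G : Graph n) (regular : Regular (2 * d) G) where

  activeNbrs+inactiveNbrs≡d+d : ∀ x v → activeNbrs G x v + inactiveNbrs G x v ≡ d + d
  activeNbrs+inactiveNbrs≡d+d x v =
    trans (activeNbrs+inactiveNbrs≡deg G x v) (trans (regular v) (cong (d +_) (+-identityʳ d)))

  majStep≡true⇒2d< : ∀ x v → majStep G x v ≡ true →
    2 * d < 2 * activeNbrs G x v + b2n (x v)
  majStep≡true⇒2d< x v active =
    subst (_< 2 * activeNbrs G x v + b2n (x v)) (regular v) (majStep≡true⇒ G x v active)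

  active⇒inactiveNbrs≤d : ∀ {x v} → x v ≡ true → majStep G x v ≡ true →
    inactiveNbrs G x v ≤ d
  active⇒inactiveNbrs≤d {x} {v} xv≡true stays = +-cancelˡ-≤ d _ _ (begin
    d + inactiveNbrs G x v                ≤⟨ +-monoˡ-≤ (inactiveNbrs G x v) d≤a ⟩
    activeNbrs G x v + inactiveNbrs G x v ≡⟨ activeNbrs+inactiveNbrs≡d+d x v ⟩
    d + d                                 ∎)
    where
    open ≤-Reasoning
    d≤a : d ≤ activeNbrs G x v
    d≤a = 2*m<2*n+1⇒m≤n (subst (λ b → 2 * d < 2 * activeNbrs G x v + b2n b) xv≡true
                                (majStep≡true⇒2d< x v stays))

  newlyActive⇒inactiveNbrs+2≤activeNbrs : ∀ {x v} →
    x ⊆ majStep G x → newlyActive x (majStep G x) v ≡ true →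
    inactiveNbrs G (majStep G x) v + 2 ≤ activeNbrs G x v
  newlyActive⇒inactiveNbrs+2≤activeNbrs {x} {v} x⊆y new = +-cancelʳ-≤ a _ _ (begin
    inactiveNbrs G (majStep G x) v + 2 + a
      ≤⟨ +-monoˡ-≤ a (+-monoˡ-≤ 2 (inactiveNbrs-antitone G x⊆y v)) ⟩
    inactiveNbrs G x v + 2 + a   ≡⟨ regroup (inactiveNbrs G x v) a ⟩
    2 + (a + inactiveNbrs G x v) ≡⟨ cong (2 +_) (activeNbrs+inactiveNbrs≡d+d x v) ⟩
    2 + (d + d)                  ≡⟨ cong suc (+-suc d d) ⟨
    suc d + suc d                ≤⟨ +-mono-≤ d<a d<a ⟩
    a + a                        ∎)
    where
    open ≤-Reasoning
    a = activeNbrs G x v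
    d<a : d < a
    d<a with xv≡false , active ← newlyActive≡true {x = x} {majStep G x} new =
      2*m<2*n+0⇒m<n (subst (λ b → 2 * d < 2 * a + b2n b) xv≡false
                            (majStep≡true⇒2d< x v active))
    regroup : ∀ i a → i + 2 + a ≡ 2 + (a + i)
    regroup = solve-∀

  majStep-cut+2*size≤ : ∀ {x} → x ⊆ majStep G x →
    cut G (majStep G x) + 2 * size (majStep G x) ≤ cut G x + 2 * size x
  majStep-cut+2*size≤ {x} x⊆y =
    potential-drop {p = P} {q = Q} {k = B} {s = size x}
      (cut-exchange G x⊆y) margins (size-⊆ x⊆y)
    where
    new : Config n
    new = newlyActive x (majStep G x)
    B P Q : ℕ
    B = ∑[ v < n ] b2n (new v)
    P = ∑[ v < n ] (b2n (new v) * activeNbrs G x v)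
    Q = ∑[ v < n ] (b2n (new v) * inactiveNbrs G (majStep G x) v)
    margin : ∀ v → b2n (new v) * inactiveNbrs G (majStep G x) v + 2 * b2n (new v)
                   ≤ b2n (new v) * activeNbrs G x v
    margin v = subst (_≤ b2n (new v) * activeNbrs G x v)
                     (distrib (b2n (new v)) (inactiveNbrs G (majStep G x) v))
                     (b2n-*-monoʳ-≤ (newlyActive⇒inactiveNbrs+2≤activeNbrs x⊆y))
      where
      distrib : ∀ b i → b * (i + 2) ≡ b * i + 2 * b
      distrib = solve-∀
    margins : Q + 2 * B ≤ P
    margins = begin
      Q + 2 * B
        ≡⟨ cong (Q +_) (*-distribˡ-sum 2 (b2n ∘ new)) ⟩
      Q + ∑[ v < n ] (2 * b2n (new v))
        ≡⟨ ∑-distrib-+ (λ v → b2n (new v) * inactiveNbrs G (majStep G x) v)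
                       (λ v → 2 * b2n (new v)) ⟨
      ∑[ v < n ] (b2n (new v) * inactiveNbrs G (majStep G x) v + 2 * b2n (new v))
        ≤⟨ ∑-mono-≤ margin ⟩
      P ∎
      where open ≤-Reasoning

  majIter-cut+2*size≤ : ∀ {ω} → IsMonotone G ω → ∀ t →
    cut G (majIter G ω t) + 2 * size (majIter G ω t) ≤ cut G ω + 2 * size ω
  majIter-cut+2*size≤ mono zero    = ≤-refl
  majIter-cut+2*size≤ mono (suc t) =
    ≤-trans (majStep-cut+2*size≤ (mono t)) (majIter-cut+2*size≤ mono t)

  cut≤d*size : ∀ {x} → x ⊆ majStep G x → cut G x ≤ d * size x
  cut≤d*size {x} x⊆y = begin
    cut G x                    ≤⟨ ∑-mono-≤ bound ⟩
    ∑[ v < n ] (d * b2n (x v)) ≡⟨ *-distribˡ-sum d (b2n ∘ x) ⟨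
    d * ∑[ v < n ] b2n (x v)   ≡⟨ cong (d *_) (count≡∑ x) ⟨
    d * size x                 ∎
    where
    open ≤-Reasoning
    bound : ∀ v → b2n (x v) * inactiveNbrs G x v ≤ d * b2n (x v)
    bound v = subst (b2n (x v) * inactiveNbrs G x v ≤_) (*-comm (b2n (x v)) d)
                (b2n-*-monoʳ-≤ λ active → active⇒inactiveNbrs≤d active
                  (true≤⇒≡true (subst (Bool._≤ majStep G x v) active (x⊆y v))))

lemma6 : (d n : ℕ) → 1 ≤ d → (G : Graph n) → Regular (2 * d) G →
    (ω : Config n) → IsMonotoneDynamo G ω →
    2 * n ≤ (d + 2) * size ω
lemma6 d n _ G regular ω ((T , all-active) , mono) = begin
  2 * n                   ≡⟨ cong (2 *_) (size-all-active (all-active T ≤-refl)) ⟨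
  2 * size ωT             ≤⟨ m≤n+m (2 * size ωT) (cut G ωT) ⟩
  cut G ωT + 2 * size ωT  ≤⟨ majIter-cut+2*size≤ d G regular mono T ⟩
  cut G ω + 2 * size ω    ≤⟨ +-monoˡ-≤ (2 * size ω) (cut≤d*size d G regular (mono 0)) ⟩
  d * size ω + 2 * size ω ≡⟨ *-distribʳ-+ (size ω) d 2 ⟨
  (d + 2) * size ω        ∎
  where
  open ≤-Reasoning
  ωT = majIter G ω T
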